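{- For any $\alpha,\alpha',n\in\mathbb{Z}^+$ and any $(A,B)\in\mathcal{T}(\alpha,[n])$, we have $|\mathcal{T}(\alpha',A)|\le|\mathcal{T}(\alpha',[\alpha])|$.
   Context: $[n]=\{1,\dots,n\}$. $A+B$ is the Minkowski sum. For finite $C\subset\mathbb{Z}$ and $\alpha\in\mathbb{Z}^+$, $\mathcal{T}(\alpha,C)$ is the set of pairs $(X,Y)$ of finite subsets of $\mathbb{Z}$ with $X+Y=C$, $|C|=|X||Y|$, $|X|=\alpha$, $0\in Y$ and $\min Y\ge 0$. -}

module Defs where

open import Data.Integer using (ℤ; +_; _+_; _<_; _≤_; 0ℤ)
open import Data.Nat as ℕ using (ℕ; suc)
open import Data.Product using (Σ; ∃; ∃-syntax; _×_; _,_)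
open import Data.List using (List; length; applyUpTo)
open import Data.List.Membership.Propositional using (_∈_)
open import Data.List.Relation.Unary.All using (All)
open import Data.List.Relation.Unary.Linked using (Linked)
open import Function.Bundles using (_⇔_)
open import Relation.Binary.PropositionalEquality using (_≡_)

-- A finite subset of ℤ is represented canonically by a strictly increasing list.
IsFinSet : List ℤ → Set
IsFinSet L = Linked _<_ L

interval : ℕ → List ℤ
interval n = applyUpTo (λ i → + suc i) n

IsSumset : List ℤ → List ℤ → List ℤ → Set
IsSumset X Y C = ∀ z → (z ∈ C) ⇔ (∃[ x ] ∃[ y ] (x ∈ X × y ∈ Y × z ≡ x + y))

InT : ℕ → List ℤ → List ℤ × List ℤ → Set
InT α C (X , Y) =
  IsFinSet X × IsFinSet Y × IsSumset X Y C
  × length C ≡ length X ℕ.* length Y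
  × length X ≡ α
  × 0ℤ ∈ Y × All (0ℤ ≤_) Y

CardLe : (List ℤ × List ℤ → Set) → (List ℤ × List ℤ → Set) → Set
CardLe P Q =
  Σ (List ℤ × List ℤ → List ℤ × List ℤ) λ f →
    (∀ p → P p → Q (f p))
    × (∀ p q → P p → P q → f p ≡ f q → p ≡ q)

-- Write A = 1 + D. Then D ⊕ B = [0, n), and the rank map r(d) = #{d′ ∈ D ∣ d′ < d} is an
-- order-preserving bijection from D onto [0, α). The heart of the proof is that r is additive:
-- r(x + y) = r(x) + r(y) whenever x, y, x + y ∈ D. This comes from the structure of interval
-- tilings: if s ≥ 2 is the least number missing from D (or from B), a left-to-right sweep shows
-- that this set is a union of blocks [qs, qs + s) while the other lies in sℕ, and dividing by s
-- yields a tiling of [0, n / s) to which induction applies; a carry between blocks is impossible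
-- because 1 lies in the contracted partner set. Given X + Y = A with |A| = |X||Y|, 0 ∈ Y ⊆ ℕ,
-- one has X ⊆ 1 + D and Y ⊆ D, and x ↦ 1 + r(x − 1), y ↦ r(y) maps (X, Y) injectively to a
-- factorisation of [1, α].

module Submission where

open import Data.Bool using (Bool; true; false; T)
open import Data.Bool.Properties using (T-≡)
open import Data.Empty using (⊥; ⊥-elim)
open import Data.Integer as ℤ using (ℤ; 0ℤ)
import Data.Integer.Properties as ℤ
open import Data.List using (List; []; _∷_; length; map; _++_; cartesianProductWith)
open import Data.List.Properties using (length-++; length-map; length-applyUpTo; ∷-injectiveˡ; ∷-injectiveʳ)
open import Data.List.Membership.Propositional using (_∈_; _∉_)
open import Data.List.Membership.Propositional.Properties
  using (∈-map⁺; ∈-map⁻; ∈-++⁺ˡ; ∈-++⁺ʳ; ∈-++⁻; ∈-applyUpTo⁺; ∈-applyUpTo⁻;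
         ∈-cartesianProductWith⁺; ∈-cartesianProductWith⁻)
open import Data.List.Membership.DecPropositional ℤ._≟_ using (_∈?_)
open import Data.List.Relation.Binary.Subset.Propositional using (_⊆_)
open import Data.List.Relation.Unary.All as All using (All)
import Data.List.Relation.Unary.All.Properties as All
import Data.List.Relation.Unary.AllPairs as AllPairs
open import Data.List.Relation.Unary.Any using (here; there)
open import Data.List.Relation.Unary.Linked using (Linked)
open import Data.List.Relation.Unary.Linked.Properties using (Linked⇒AllPairs)
open import Data.List.Relation.Unary.Unique.Propositional using (Unique)
open import Data.List.Relation.Unary.Unique.Propositional.Properties using (applyUpTo⁺₁)
open import Data.Nat
open import Data.Nat.Divisibility
  using (_∣_; divides; divides-refl; ∣⇒≤; ∣1⇒≡1; ∣m∣n⇒∣m+n; ∣m+n∣m⇒∣n; n∣m*n; m%n≡0⇒n∣m)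
open import Data.Nat.DivMod using (_/_; _%_; m≡m%n+[m/n]*n; m%n<n)
open import Data.Nat.Induction using (<-rec)
open import Data.Nat.Properties
open import Algebra.Properties.CommutativeSemigroup +-commutativeSemigroup
  using () renaming (interchange to +-interchange)
open import Data.Nat.Tactic.RingSolver using (solve)
open import Data.Product using (∃; ∃₂; _×_; _,_; proj₁; proj₂)
open import Data.Sum using (_⊎_; inj₁; inj₂)
open import Function using (_∘_)
open import Function.Bundles using (Equivalence; mk⇔)
open import Relation.Binary.Definitions using (DecidableEquality; tri<; tri≈; tri>)
open import Relation.Binary.PropositionalEquality
open import Relation.Nullary using (¬_; Dec; yes; no; does; T?)
open import Relation.Nullary.Decidable using (dec-true; dec-false; does-⇔)

open import Defs

T-ext : ∀ {a b} → (T a → T b) → (T b → T a) → a ≡ b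
T-ext {false} {false} _ _ = refl
T-ext {false} {true}  _ g = ⊥-elim (g _)
T-ext {true}  {false} f _ = ⊥-elim (f _)
T-ext {true}  {true}  _ _ = refl

does-sound : ∀ {A : Set} (a? : Dec A) → T (does a?) → A
does-sound (yes a) _ = a

does-complete : ∀ {A : Set} (a? : Dec A) → A → T (does a?)
does-complete (yes _) _ = _
does-complete (no ¬a) a = ¬a a

nonmultiple : ∀ {s w} → 0 < w → w < s → ¬ s ∣ w
nonmultiple 0<w w<s s∣w = <⇒≱ w<s (∣⇒≤ {{>-nonZero 0<w}} s∣w)

record Tiling (D B : ℕ → Bool) (n : ℕ) : Set where
  field
    cover  : ∀ m → m < n → ∃₂ λ d b → T (D d) × T (B b) × m ≡ d + b
    bound  : ∀ d b → T (D d) → T (B b) → d + b < n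
    unique : ∀ d b d′ b′ → T (D d) → T (B b) → T (D d′) → T (B b′) →
             d + b ≡ d′ + b′ → d ≡ d′
    0∈D    : T (D 0)
    0∈B    : T (B 0)

open Tiling

module _ {D B : ℕ → Bool} {n : ℕ} (t : Tiling D B n) where

  uniqueʳ : ∀ d b d′ b′ → T (D d) → T (B b) → T (D d′) → T (B b′) →
            d + b ≡ d′ + b′ → b ≡ b′
  uniqueʳ d b d′ b′ d∈D b∈B d′∈D b′∈B eq =
    +-cancelˡ-≡ d b b′ (trans eq (cong (_+ b′) (sym (unique t d b d′ b′ d∈D b∈B d′∈D b′∈B eq))))

  swap : Tiling B D n
  swap = record
    { cover  = λ m m<n → let d , b , d∈D , b∈B , m≡d+b = cover t m m<n
                         in b , d , b∈B , d∈D , trans m≡d+b (+-comm d b)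
    ; bound  = λ b d b∈B d∈D → subst (_< n) (+-comm d b) (bound t d b d∈D b∈B)
    ; unique = λ b d b′ d′ b∈B d∈D b′∈B d′∈D eq →
        uniqueʳ d b d′ b′ d∈D b∈B d′∈D b′∈B (trans (+-comm d b) (trans eq (+-comm b′ d′)))
    ; 0∈D    = 0∈B t
    ; 0∈B    = 0∈D t
    }

  ∈D⇒<n : ∀ d → T (D d) → d < n
  ∈D⇒<n d d∈D = subst (_< n) (+-identityʳ d) (bound t d 0 d∈D (0∈B t))

  n>0 : n > 0
  n>0 = ∈D⇒<n 0 (0∈D t)

  full-B⇒D≡0 : (∀ m → m < n → T (B m)) → ∀ d → T (D d) → d ≡ 0
  full-B⇒D≡0 full d d∈D =
    unique t d 0 0 d d∈D (0∈B t) (0∈D t) (full d (∈D⇒<n d d∈D)) (+-comm d 0)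

  1∉D⇒1∈B : 1 < n → ¬ T (D 1) → T (B 1)
  1∉D⇒1∈B 1<n 1∉D with cover t 1 1<n
  ... | 0 , b , _ , b∈B , refl = b∈B
  ... | 1 , 0 , 1∈D , _ , _ = ⊥-elim (1∉D 1∈D)

least-nonmember : (D : ℕ → Bool) (n : ℕ) →
  (∀ m → m < n → T (D m)) ⊎ ∃ λ s → s < n × ¬ T (D s) × (∀ m → m < s → T (D m))
least-nonmember D zero = inj₁ λ _ ()
least-nonmember D (suc n) with least-nonmember D n
... | inj₂ (s , s<n , s∉D , below) = inj₂ (s , m<n⇒m<1+n s<n , s∉D , below)
... | inj₁ below with T? (D n)
...   | no n∉D = inj₂ (n , n<1+n n , n∉D , below)
...   | yes n∈D = inj₁ below′
  where
  below′ : ∀ m → m < suc n → T (D m)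
  below′ m m<1+n with m<1+n⇒m<n∨m≡n m<1+n
  ... | inj₁ m<n  = below m m<n
  ... | inj₂ refl = n∈D

record Decomposition (D B : ℕ → Bool) (n : ℕ) : Set where
  field
    s           : ℕ
    1<s         : 1 < s
    n₁          : ℕ
    n≡n₁*s      : n ≡ n₁ * s
    s∈B         : T (B s)
    B-multiple  : ∀ b → T (B b) → s ∣ b
    D-blockwise : ∀ q r → r < s → D (q * s + r) ≡ D (q * s)
    contraction : Tiling (λ q → D (q * s)) (λ q → B (q * s)) n₁

  instance
    s-nonZero : NonZero s
    s-nonZero = >-nonZero (<⇒≤ 1<s)

module BlockStructure {D B : ℕ → Bool} {n : ℕ} (t : Tiling D B n)
  (s : ℕ) .{{_ : NonZero s}}
  (prefix⊆D : ∀ m → m < s → T (D m)) (s∉D : ¬ T (D s)) (s<n : s < n) where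

  0<s : 0 < s
  0<s = >-nonZero⁻¹ s

  B<s⇒≡0 : ∀ b → T (B b) → b < s → b ≡ 0
  B<s⇒≡0 b b∈B b<s =
    unique t b 0 0 b (prefix⊆D b b<s) (0∈B t) (0∈D t) b∈B (+-comm b 0)

  s∈B : T (B s)
  s∈B with cover t s s<n
  ... | d , b , d∈D , b∈B , s≡d+b with b <? s
  ...   | yes b<s = ⊥-elim (s∉D (subst (T ∘ D) (sym s≡d) d∈D))
    where
    s≡d : s ≡ d
    s≡d = trans s≡d+b (trans (cong (d +_) (B<s⇒≡0 b b∈B b<s)) (+-identityʳ d))
  ...   | no b≮s = subst (T ∘ B) (≤-antisym b≤s (≮⇒≥ b≮s)) b∈B
    where
    b≤s : b ≤ s
    b≤s = subst (b ≤_) (sym s≡d+b) (m≤n+m b d)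

  -- The invariant of the sweep over the blocks [js, js + s).
  record Regular (j : ℕ) : Set where
    field
      B-multiple  : ∀ b → T (B b) → b < j * s → s ∣ b
      D-blockwise : ∀ q r → q < j → r < s → D (q * s + r) ≡ D (q * s)

  js+s<n : ∀ j → T (D (j * s)) → j * s + s < n
  js+s<n j js∈D = bound t (j * s) s js∈D s∈B

  no-cover-below : ∀ j → Regular j → T (D (j * s)) → ∀ r d b → r < s → T (D d) → T (B b) →
                0 < b → b < j * s → j * s + r ≡ d + b → ⊥
  no-cover-below j reg js∈D r d b r<s d∈D b∈B 0<b b<js eq
    with Regular.B-multiple reg b b∈B b<js
  ... | divides-refl p with m≤n⇒∃[o]m+o≡n (<⇒≤ (*-cancelʳ-< s p j b<js))
  ...   | q , p+q≡j = <-irrefl (*-cancelʳ-≡ q j s qs≡js) q<j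
    where
    p>0 : p > 0
    p>0 = n≢0⇒n>0 λ { refl → <-irrefl refl 0<b }
    q<j : q < j
    q<j = subst (q <_) p+q≡j (m<n+m q p>0)
    d≡qs+r : d ≡ q * s + r
    d≡qs+r = +-cancelʳ-≡ (p * s) d (q * s + r) (begin
      d + p * s            ≡⟨ sym eq ⟩
      j * s + r            ≡⟨ cong (λ x → x * s + r) (sym p+q≡j) ⟩
      (p + q) * s + r      ≡⟨ solve (p ∷ q ∷ s ∷ r ∷ []) ⟩
      q * s + r + p * s    ∎)
      where open ≡-Reasoning
    qs∈D : T (D (q * s))
    qs∈D = subst T (Regular.D-blockwise reg q r q<j r<s) (subst (T ∘ D) d≡qs+r d∈D)
    qs≡js : q * s ≡ j * s
    qs≡js = unique t (q * s) (p * s) (j * s) 0 qs∈D b∈B js∈D (0∈B t) (begin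
      q * s + p * s        ≡⟨ solve (q ∷ p ∷ s ∷ []) ⟩
      (p + q) * s + 0      ≡⟨ cong (λ x → x * s + 0) p+q≡j ⟩
      j * s + 0            ∎)
      where open ≡-Reasoning

  -- w = s ∸ u lies in [0, s) ⊆ D, and w + b = js + s would be a second representation.
  no-cover-above : ∀ j → T (D (j * s)) → ∀ r d b → r < s → T (D d) → T (B b) →
                b ≢ 0 → j * s ≤ b → j * s + r ≡ d + b → ⊥
  no-cover-above j js∈D r d b r<s d∈D b∈B b≢0 js≤b eq with m≤n⇒∃[o]m+o≡n js≤b
  ... | zero , refl = b≢0 (trans (+-identityʳ (j * s))
                        (sym (unique t 0 (j * s + 0) (j * s) 0 (0∈D t) b∈B js∈D (0∈B t) refl)))
  ... | suc u′ , refl = nonmultiple (m<n⇒0<n∸m u<s) w<s (divides j w≡js)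
    where
    u = suc u′
    d+u≡r : d + u ≡ r
    d+u≡r = +-cancelˡ-≡ (j * s) (d + u) r (begin
      j * s + (d + u)      ≡⟨ solve (j ∷ s ∷ d ∷ u′ ∷ []) ⟩
      d + (j * s + u)      ≡⟨ sym eq ⟩
      j * s + r            ∎)
      where open ≡-Reasoning
    u<s : u < s
    u<s = ≤-<-trans (subst (u ≤_) d+u≡r (m≤n+m u d)) r<s
    w = s ∸ u
    w<s : w < s
    w<s = ∸-monoʳ-< z<s (<⇒≤ u<s)
    w≡js : w ≡ j * s
    w≡js = unique t w (j * s + u) (j * s) s (prefix⊆D w w<s) b∈B js∈D s∈B (begin
      w + (j * s + u)      ≡⟨ trans (+-comm w (j * s + u)) (+-assoc (j * s) u w) ⟩
      j * s + (u + w)      ≡⟨ cong (j * s +_) (m+[n∸m]≡n (<⇒≤ u<s)) ⟩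
      j * s + s            ∎)
      where open ≡-Reasoning

  block-full : ∀ j → Regular j → T (D (j * s)) → ∀ r → r < s → T (D (j * s + r))
  block-full j reg js∈D r r<s with cover t (j * s + r) (<-trans (+-monoʳ-< (j * s) r<s) (js+s<n j js∈D))
  ... | d , b , d∈D , b∈B , eq with b ≟ 0
  ...   | yes refl = subst (T ∘ D) (sym (trans eq (+-identityʳ d))) d∈D
  ...   | no b≢0 with b <? j * s
  ...     | yes b<js = ⊥-elim (no-cover-below j reg js∈D r d b r<s d∈D b∈B (n≢0⇒n>0 b≢0) b<js eq)
  ...     | no b≮js = ⊥-elim (no-cover-above j js∈D r d b r<s d∈D b∈B b≢0 (≮⇒≥ b≮js) eq)

  block-covering : ∀ j → Regular j → j * s < n →
                   ∃₂ λ q b → T (B b) × j * s ≡ q * s + b × (∀ r → r < s → T (D (q * s + r)))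
  block-covering j reg js<n with cover t (j * s) js<n
  ... | d , b , d∈D , b∈B , js≡d+b with b ≟ 0
  ...   | yes refl = j , 0 , 0∈B t , sym (+-identityʳ (j * s)) , block-full j reg js∈D
    where
    js∈D : T (D (j * s))
    js∈D = subst (T ∘ D) (sym (trans js≡d+b (+-identityʳ d))) d∈D
  ...   | no b≢0 with b <? j * s
  ...     | no b≮js = 0 , b , b∈B , trans js≡d+b (cong (_+ b) d≡0) , prefix⊆D
    where
    d≡0 : d ≡ 0
    d≡0 = +-cancelʳ-≡ b d 0 (≤-antisym (subst (_≤ b) js≡d+b (≮⇒≥ b≮js)) (m≤n+m b d))
  ...     | yes b<js with ∣m+n∣m⇒∣n (subst (s ∣_) (trans js≡d+b (+-comm d b)) (n∣m*n j))
                                    (Regular.B-multiple reg b b∈B b<js)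
  ...       | divides-refl q = q , b , b∈B , js≡d+b , block
    where
    q<j : q < j
    q<j = *-cancelʳ-< s q j (subst (q * s <_) (sym js≡d+b) (m<m+n (q * s) (n≢0⇒n>0 b≢0)))
    block : ∀ r → r < s → T (D (q * s + r))
    block r r<s = subst T (sym (Regular.D-blockwise reg q r q<j r<s)) d∈D

  module NextBlock (j : ℕ) (reg : Regular j) (q b : ℕ) (b∈B : T (B b)) (js≡qs+b : j * s ≡ q * s + b)
                   (block : ∀ r → r < s → T (D (q * s + r))) where

    shifted : ∀ r → j * s + r ≡ (q * s + r) + b
    shifted r = begin
      j * s + r            ≡⟨ cong (_+ r) js≡qs+b ⟩
      q * s + b + r        ≡⟨ solve (q ∷ s ∷ b ∷ r ∷ []) ⟩
      q * s + r + b        ∎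
      where open ≡-Reasoning

    fits : suc j * s ≤ n
    fits = subst (_≤ n) last+1≡sjs
      (bound t (q * s + pred s) b (block (pred s) (≤-reflexive (suc-pred s))) b∈B)
      where
      open ≡-Reasoning
      last+1≡sjs : suc (q * s + pred s + b) ≡ s + j * s
      last+1≡sjs = begin
        suc (q * s + pred s + b)   ≡⟨ cong suc (sym (shifted (pred s))) ⟩
        suc (j * s + pred s)       ≡⟨ sym (+-suc (j * s) (pred s)) ⟩
        j * s + suc (pred s)       ≡⟨ cong (j * s +_) (suc-pred s) ⟩
        j * s + s                  ≡⟨ +-comm (j * s) s ⟩
        s + j * s                  ∎

    hit⇒q≡j : ∀ r → r < s → T (D (j * s + r)) → q ≡ j
    hit⇒q≡j r r<s hit = sym (*-cancelʳ-≡ j q s (+-cancelʳ-≡ r (j * s) (q * s)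
      (unique t (j * s + r) 0 (q * s + r) b hit (0∈B t) (block r r<s) b∈B
        (trans (+-identityʳ _) (shifted r)))))

    D-blockwise-next : ∀ q′ r → q′ < suc j → r < s → D (q′ * s + r) ≡ D (q′ * s)
    D-blockwise-next q′ r q′<sj r<s with m<1+n⇒m<n∨m≡n q′<sj
    ... | inj₁ q′<j = Regular.D-blockwise reg q′ r q′<j r<s
    ... | inj₂ refl = T-ext
      (λ js+r∈D → subst (T ∘ D) (+-identityʳ (j * s))
                    (subst (λ x → T (D (x * s + 0))) (hit⇒q≡j r r<s js+r∈D) (block 0 0<s)))
      (λ js∈D → subst (λ x → T (D (x * s + r)))
                  (hit⇒q≡j 0 0<s (subst (T ∘ D) (sym (+-identityʳ (j * s))) js∈D)) (block r r<s))

    B-multiple-next : ∀ b′ → T (B b′) → b′ < suc j * s → s ∣ b′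
    B-multiple-next b′ b′∈B b′<sjs with b′ <? j * s
    ... | yes b′<js = Regular.B-multiple reg b′ b′∈B b′<js
    ... | no b′≮js with m≤n⇒∃[o]m+o≡n (≮⇒≥ b′≮js)
    ...   | r , refl = subst (s ∣_) (sym (trans (cong (j * s +_) r≡0) (+-identityʳ (j * s)))) (n∣m*n j)
      where
      r<s : r < s
      r<s = +-cancelˡ-< (j * s) r s (subst (j * s + r <_) (+-comm s (j * s)) b′<sjs)
      r≡0 : r ≡ 0
      r≡0 = m+n≡0⇒n≡0 (q * s) (sym (unique t 0 (j * s + r) (q * s + r) b
              (0∈D t) b′∈B (block r r<s) b∈B (shifted r)))

  step : ∀ j → Regular j → j * s < n → Regular (suc j) × suc j * s ≤ n
  step j reg js<n with block-covering j reg js<n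
  ... | q , b , b∈B , js≡qs+b , block =
    record { B-multiple = B-multiple-next ; D-blockwise = D-blockwise-next } , fits
    where open NextBlock j reg q b b∈B js≡qs+b block

  regular : ∀ j → j * s ≤ n → Regular j
  regular zero    _      = record { B-multiple = λ _ _ () ; D-blockwise = λ _ _ () }
  regular (suc j) sjs≤n  = proj₁ (step j (regular j (<⇒≤ js<n)) js<n)
    where
    js<n : j * s < n
    js<n = <-≤-trans (m<n+m (j * s) 0<s) sjs≤n

  -- An incomplete last block would be followed by a whole block beyond n.
  s∣n : s ∣ n
  s∣n with n % s ≟ 0
  ... | yes n%s≡0 = m%n≡0⇒n∣m n s n%s≡0
  ... | no n%s≢0 = ⊥-elim (<⇒≱ n<s+qs (proj₂ (step q (regular q (<⇒≤ qs<n)) qs<n)))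
    where
    q = n / s
    n≡r+qs : n ≡ n % s + q * s
    n≡r+qs = m≡m%n+[m/n]*n n s
    qs<n : q * s < n
    qs<n = subst (q * s <_) (sym n≡r+qs) (m<n+m (q * s) (n≢0⇒n>0 n%s≢0))
    n<s+qs : n < s + q * s
    n<s+qs = subst (_< s + q * s) (sym n≡r+qs) (+-monoˡ-< (q * s) (m%n<n n s))

  n₁ : ℕ
  n₁ = _∣_.quotient s∣n

  n≡n₁*s : n ≡ n₁ * s
  n≡n₁*s = _∣_.equality s∣n

  regular-n₁ : Regular n₁
  regular-n₁ = regular n₁ (≤-reflexive (sym n≡n₁*s))

  B-multiple : ∀ b → T (B b) → s ∣ b
  B-multiple b b∈B = Regular.B-multiple regular-n₁ b b∈B (subst (b <_) n≡n₁*s (∈D⇒<n (swap t) b b∈B))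

  D-blockwise : ∀ q r → r < s → D (q * s + r) ≡ D (q * s)
  D-blockwise q r r<s with q <? n₁
  ... | yes q<n₁ = Regular.D-blockwise regular-n₁ q r q<n₁ r<s
  ... | no q≮n₁ = T-ext (λ h → ⊥-elim (beyond (q * s + r) (≤-trans n≤qs (m≤m+n (q * s) r)) h))
                        (λ h → ⊥-elim (beyond (q * s) n≤qs h))
    where
    beyond : ∀ d → n ≤ d → ¬ T (D d)
    beyond d n≤d d∈D = <⇒≱ (∈D⇒<n t d d∈D) n≤d
    n≤qs : n ≤ q * s
    n≤qs = subst (_≤ q * s) (sym n≡n₁*s) (*-monoˡ-≤ s (≮⇒≥ q≮n₁))

  contraction : Tiling (λ q → D (q * s)) (λ q → B (q * s)) n₁
  contraction = record
    { cover  = contraction-cover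
    ; bound  = λ d b d∈D b∈B → *-cancelʳ-< s (d + b) n₁
                 (subst₂ _<_ (sym (*-distribʳ-+ s d b)) n≡n₁*s (bound t (d * s) (b * s) d∈D b∈B))
    ; unique = λ d b d′ b′ d∈D b∈B d′∈D b′∈B eq → *-cancelʳ-≡ d d′ s
                 (unique t (d * s) (b * s) (d′ * s) (b′ * s) d∈D b∈B d′∈D b′∈B
                   (trans (sym (*-distribʳ-+ s d b)) (trans (cong (_* s) eq) (*-distribʳ-+ s d′ b′))))
    ; 0∈D    = 0∈D t
    ; 0∈B    = 0∈B t
    }
    where
    contraction-cover : ∀ m → m < n₁ → ∃₂ λ d b → T (D (d * s)) × T (B (b * s)) × m ≡ d + b
    contraction-cover m m<n₁ with cover t (m * s) (subst (m * s <_) (sym n≡n₁*s) (*-monoˡ-< s m<n₁))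
    ... | d , b , d∈D , b∈B , ms≡d+b with B-multiple b b∈B
    ...   | divides-refl qb with ∣m+n∣m⇒∣n (subst (s ∣_) (trans ms≡d+b (+-comm d (qb * s))) (n∣m*n m))
                                         (n∣m*n qb)
    ...     | divides-refl qd = qd , qb , d∈D , b∈B ,
                *-cancelʳ-≡ m (qd + qb) s (trans ms≡d+b (sym (*-distribʳ-+ s qd qb)))

  decomposition : 1 < s → Decomposition D B n
  decomposition 1<s = record
    { s           = s
    ; 1<s         = 1<s
    ; n₁          = n₁
    ; n≡n₁*s      = n≡n₁*s
    ; s∈B         = s∈B
    ; B-multiple  = B-multiple
    ; D-blockwise = D-blockwise
    ; contraction = contraction
    }

decompose : ∀ {D B n} → Tiling D B n → T (D 1) → (∀ m → m < n → T (D m)) ⊎ Decomposition D B n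
decompose {D} {n = n} t 1∈D with least-nonmember D n
... | inj₁ full                        = inj₁ full
... | inj₂ (0 , _ , 0∉D , _)           = ⊥-elim (0∉D (0∈D t))
... | inj₂ (1 , _ , 1∉D , _)           = ⊥-elim (1∉D 1∈D)
... | inj₂ (s@(suc (suc _)) , s<n , s∉D , prefix⊆D) =
      inj₂ (BlockStructure.decomposition t s prefix⊆D s∉D s<n (s≤s (s≤s z≤n)))

fromBool : Bool → ℕ
fromBool true  = 1
fromBool false = 0

rank : (ℕ → Bool) → ℕ → ℕ
rank D zero    = 0
rank D (suc k) = rank D k + fromBool (D k)

module _ (D : ℕ → Bool) where

  rank-mono-≤ : ∀ {a b} → a ≤ b → rank D a ≤ rank D b
  rank-mono-≤ {a} {b} a≤b with m≤n⇒∃[o]m+o≡n a≤b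
  ... | k , refl = go k
    where
    go : ∀ k → rank D a ≤ rank D (a + k)
    go zero    = ≤-reflexive (cong (rank D) (sym (+-identityʳ a)))
    go (suc k) = subst (rank D a ≤_) (cong (rank D) (sym (+-suc a k)))
                   (≤-trans (go k) (m≤m+n _ _))

  rank-strict : ∀ {a b} → T (D a) → a < b → rank D a < rank D b
  rank-strict {a} a∈D a<b = ≤-trans (≤-reflexive step) (rank-mono-≤ a<b)
    where
    step : suc (rank D a) ≡ rank D a + fromBool (D a)
    step with D a
    ... | true = +-comm 1 (rank D a)

  rank-injective : ∀ {a b} → T (D a) → T (D b) → rank D a ≡ rank D b → a ≡ b
  rank-injective {a} {b} a∈D b∈D eq with <-cmp a b
  ... | tri< a<b _ _ = ⊥-elim (<-irrefl eq (rank-strict a∈D a<b))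
  ... | tri≈ _ a≡b _ = a≡b
  ... | tri> _ _ b<a = ⊥-elim (<-irrefl (sym eq) (rank-strict b∈D b<a))

  rank-surjective : ∀ k i → i < rank D k → ∃ λ d → d < k × T (D d) × rank D d ≡ i
  rank-surjective (suc k) i i<rank[k+1] with i <? rank D k
  ... | yes i<rank[k] = let d , d<k , d∈D , eq = rank-surjective k i i<rank[k]
                        in d , m<n⇒m<1+n d<k , d∈D , eq
  ... | no i≮rank[k] with D k in Dk≡
  ...   | true  = k , n<1+n k , subst T (sym Dk≡) _ ,
                  ≤-antisym (≮⇒≥ i≮rank[k]) (≤-pred (subst (i <_) (+-comm (rank D k) 1) i<rank[k+1]))
  ...   | false = ⊥-elim (i≮rank[k] (subst (i <_) (+-identityʳ (rank D k)) i<rank[k+1]))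

  rank-full : ∀ {n} → (∀ m → m < n → T (D m)) → ∀ k → k ≤ n → rank D k ≡ k
  rank-full full zero    _    = refl
  rank-full full (suc k) k<n with D k | full k k<n
  ... | true | _ = trans (cong (_+ 1) (rank-full full k (<⇒≤ k<n))) (+-comm k 1)

rank-pointwise-+ : ∀ {D E F : ℕ → Bool} → (∀ m → fromBool (D m) ≡ fromBool (E m) + fromBool (F m)) →
                   ∀ k → rank D k ≡ rank E k + rank F k
rank-pointwise-+ split zero    = refl
rank-pointwise-+ {D} {E} {F} split (suc k) =
  trans (cong₂ _+_ (rank-pointwise-+ split k) (split k))
        (+-interchange (rank E k) (rank F k) (fromBool (E k)) (fromBool (F k)))

rank-singleton-≤ : ∀ i k → k ≤ i → rank (λ m → does (m ≟ i)) k ≡ 0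
rank-singleton-≤ i zero    _   = refl
rank-singleton-≤ i (suc k) k<i =
  cong₂ _+_ (rank-singleton-≤ i k (<⇒≤ k<i)) (cong fromBool (dec-false (k ≟ i) (<⇒≢ k<i)))

rank-singleton : ∀ i k → i < k → rank (λ m → does (m ≟ i)) k ≡ 1
rank-singleton i (suc k) i<1+k with m<1+n⇒m<n∨m≡n i<1+k
... | inj₁ i<k  = cong₂ _+_ (rank-singleton i k i<k) (cong fromBool (dec-false (k ≟ i) (≢-sym (<⇒≢ i<k))))
... | inj₂ refl = cong₂ _+_ (rank-singleton-≤ i i ≤-refl) (cong fromBool (dec-true (i ≟ i) refl))

fromBool≡0 : ∀ {b} → ¬ T b → fromBool b ≡ 0
fromBool≡0 {false} _   = refl
fromBool≡0 {true}  ¬tt = ⊥-elim (¬tt _)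

Additive : (ℕ → Bool) → Set
Additive D = ∀ x y → T (D x) → T (D y) → T (D (x + y)) → rank D (x + y) ≡ rank D x + rank D y

module Dilation (D : ℕ → Bool) (s : ℕ) .{{_ : NonZero s}} where

  D₁ : ℕ → Bool
  D₁ q = D (q * s)

  digits-+ : ∀ a b c d → (a * s + c) + (b * s + d) ≡ (a + b) * s + (c + d)
  digits-+ a b c d = solve (a ∷ b ∷ s ∷ c ∷ d ∷ [])

  digits-+-carry : ∀ q₁ r₁ q₂ r₂ → r₁ < s → r₂ < s → ¬ (r₁ + r₂ < s) →
                   ∃ λ r₃ → r₃ < s × (q₁ * s + r₁) + (q₂ * s + r₂) ≡ suc (q₁ + q₂) * s + r₃
  digits-+-carry q₁ r₁ q₂ r₂ r₁<s r₂<s r₁+r₂≮s with m≤n⇒∃[o]m+o≡n (≮⇒≥ r₁+r₂≮s)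
  ... | r₃ , s+r₃≡r₁+r₂ = r₃ , r₃<s , (begin
    (q₁ * s + r₁) + (q₂ * s + r₂)   ≡⟨ digits-+ q₁ q₂ r₁ r₂ ⟩
    (q₁ + q₂) * s + (r₁ + r₂)       ≡⟨ cong ((q₁ + q₂) * s +_) (sym s+r₃≡r₁+r₂) ⟩
    (q₁ + q₂) * s + (s + r₃)        ≡⟨ solve (q₁ ∷ q₂ ∷ s ∷ r₃ ∷ []) ⟩
    suc (q₁ + q₂) * s + r₃          ∎)
    where
    open ≡-Reasoning
    r₃<s : r₃ < s
    r₃<s = +-cancelˡ-< s r₃ s (subst (_< s + s) (sym s+r₃≡r₁+r₂) (+-mono-< r₁<s r₂<s))

  digits : ∀ x → ∃₂ λ q r → r < s × x ≡ q * s + r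
  digits x = x / s , x % s , m%n<n x s , trans (m≡m%n+[m/n]*n x s) (+-comm (x % s) _)

  module Blockwise (blockwise : ∀ q r → r < s → D (q * s + r) ≡ D (q * s)) where

    rank-in-block : ∀ q r → r ≤ s → rank D (q * s + r) ≡ rank D (q * s) + r * fromBool (D₁ q)
    rank-in-block q zero    _   = trans (cong (rank D) (+-identityʳ (q * s))) (sym (+-identityʳ _))
    rank-in-block q (suc r) r<s = begin
      rank D (q * s + suc r)
        ≡⟨ cong (rank D) (+-suc (q * s) r) ⟩
      rank D (q * s + r) + fromBool (D (q * s + r))
        ≡⟨ cong₂ _+_ (rank-in-block q r (<⇒≤ r<s)) (cong fromBool (blockwise q r r<s)) ⟩
      rank D (q * s) + r * fromBool (D₁ q) + fromBool (D₁ q)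
        ≡⟨ +-assoc (rank D (q * s)) _ _ ⟩
      rank D (q * s) + (r * fromBool (D₁ q) + fromBool (D₁ q))
        ≡⟨ cong (rank D (q * s) +_) (+-comm (r * fromBool (D₁ q)) _) ⟩
      rank D (q * s) + suc r * fromBool (D₁ q)
        ∎
      where open ≡-Reasoning

    rank-at-block : ∀ q → rank D (q * s) ≡ rank D₁ q * s
    rank-at-block zero    = refl
    rank-at-block (suc q) = begin
      rank D (s + q * s)                      ≡⟨ cong (rank D) (+-comm s (q * s)) ⟩
      rank D (q * s + s)                      ≡⟨ rank-in-block q s ≤-refl ⟩
      rank D (q * s) + s * fromBool (D₁ q)    ≡⟨ cong (_+ s * fromBool (D₁ q)) (rank-at-block q) ⟩
      rank D₁ q * s + s * fromBool (D₁ q)     ≡⟨ cong (rank D₁ q * s +_) (*-comm s (fromBool (D₁ q))) ⟩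
      rank D₁ q * s + fromBool (D₁ q) * s     ≡⟨ *-distribʳ-+ s (rank D₁ q) _ ⟨
      (rank D₁ q + fromBool (D₁ q)) * s       ∎
      where open ≡-Reasoning

    rank-blockwise : ∀ q r → r < s → T (D (q * s + r)) → rank D (q * s + r) ≡ rank D₁ q * s + r
    rank-blockwise q r r<s qs+r∈D = begin
      rank D (q * s + r)                      ≡⟨ rank-in-block q r (<⇒≤ r<s) ⟩
      rank D (q * s) + r * fromBool (D₁ q)    ≡⟨ cong₂ _+_ (rank-at-block q) (cong (λ b → r * fromBool b) qs∈D) ⟩
      rank D₁ q * s + r * 1                   ≡⟨ cong (rank D₁ q * s +_) (*-identityʳ r) ⟩
      rank D₁ q * s + r                       ∎
      where
      open ≡-Reasoning
      qs∈D : D₁ q ≡ true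
      qs∈D = trans (sym (blockwise q r r<s)) (Equivalence.to T-≡ qs+r∈D)

    ∈D₁ : ∀ q r → r < s → T (D (q * s + r)) → T (D₁ q)
    ∈D₁ q r r<s = subst T (blockwise q r r<s)

    additive-blockwise : Additive D₁ →
                         (∀ q₁ q₂ → T (D₁ q₁) → T (D₁ q₂) → ¬ T (D₁ (suc (q₁ + q₂)))) →
                         Additive D
    additive-blockwise add₁ no-carry₁ x y x∈D y∈D x+y∈D with digits x | digits y
    ... | q₁ , r₁ , r₁<s , refl | q₂ , r₂ , r₂<s , refl with r₁ + r₂ <? s
    ...   | yes r₁+r₂<s = begin
      rank D ((q₁ * s + r₁) + (q₂ * s + r₂))
        ≡⟨ cong (rank D) (digits-+ q₁ q₂ r₁ r₂) ⟩
      rank D ((q₁ + q₂) * s + (r₁ + r₂))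
        ≡⟨ rank-blockwise (q₁ + q₂) (r₁ + r₂) r₁+r₂<s x+y∈D′ ⟩
      rank D₁ (q₁ + q₂) * s + (r₁ + r₂)
        ≡⟨ cong (λ k → k * s + (r₁ + r₂)) (add₁ q₁ q₂ (∈D₁ q₁ r₁ r₁<s x∈D) (∈D₁ q₂ r₂ r₂<s y∈D)
                                                  (∈D₁ (q₁ + q₂) (r₁ + r₂) r₁+r₂<s x+y∈D′)) ⟩
      (rank D₁ q₁ + rank D₁ q₂) * s + (r₁ + r₂)
        ≡⟨ digits-+ (rank D₁ q₁) (rank D₁ q₂) r₁ r₂ ⟨
      (rank D₁ q₁ * s + r₁) + (rank D₁ q₂ * s + r₂)
        ≡⟨ cong₂ _+_ (rank-blockwise q₁ r₁ r₁<s x∈D) (rank-blockwise q₂ r₂ r₂<s y∈D) ⟨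
      rank D (q₁ * s + r₁) + rank D (q₂ * s + r₂)
        ∎
      where
      open ≡-Reasoning
      x+y∈D′ = subst (T ∘ D) (digits-+ q₁ q₂ r₁ r₂) x+y∈D
    ...   | no r₁+r₂≮s with digits-+-carry q₁ r₁ q₂ r₂ r₁<s r₂<s r₁+r₂≮s
    ...     | r₃ , r₃<s , x+y≡ =
      ⊥-elim (no-carry₁ q₁ q₂ (∈D₁ q₁ r₁ r₁<s x∈D) (∈D₁ q₂ r₂ r₂<s y∈D)
                        (∈D₁ (suc (q₁ + q₂)) r₃ r₃<s (subst (T ∘ D) x+y≡ x+y∈D)))

  module Sparse (sparse : ∀ d → T (D d) → s ∣ d) where

    rank-in-gap : ∀ q r → r < s → rank D (q * s + suc r) ≡ rank D (q * s) + fromBool (D₁ q)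
    rank-in-gap q zero    _   = cong (rank D) (+-comm (q * s) 1)
    rank-in-gap q (suc r) r<s = begin
      rank D (q * s + suc (suc r))                            ≡⟨ cong (rank D) (+-suc (q * s) (suc r)) ⟩
      rank D (q * s + suc r) + fromBool (D (q * s + suc r))   ≡⟨ cong₂ _+_ (rank-in-gap q r (<⇒≤ r<s)) gap ⟩
      rank D (q * s) + fromBool (D₁ q) + 0                    ≡⟨ +-identityʳ _ ⟩
      rank D (q * s) + fromBool (D₁ q)                        ∎
      where
      open ≡-Reasoning
      gap : fromBool (D (q * s + suc r)) ≡ 0
      gap = fromBool≡0 λ h → nonmultiple z<s r<s (∣m+n∣m⇒∣n (sparse _ h) (n∣m*n q))

    rank-dilation : ∀ q → rank D (q * s) ≡ rank D₁ q
    rank-dilation zero    = refl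
    rank-dilation (suc q) = begin
      rank D (s + q * s)                    ≡⟨ cong (rank D) (+-comm s (q * s)) ⟩
      rank D (q * s + s)                    ≡⟨ cong (λ k → rank D (q * s + k)) (suc-pred s) ⟨
      rank D (q * s + suc (pred s))         ≡⟨ rank-in-gap q (pred s) (≤-reflexive (suc-pred s)) ⟩
      rank D (q * s) + fromBool (D₁ q)      ≡⟨ cong (_+ fromBool (D₁ q)) (rank-dilation q) ⟩
      rank D₁ q + fromBool (D₁ q)           ∎
      where open ≡-Reasoning

    additive-dilation : Additive D₁ → Additive D
    additive-dilation add₁ x y x∈D y∈D x+y∈D with sparse x x∈D | sparse y y∈D
    ... | divides-refl q₁ | divides-refl q₂ = begin
      rank D (q₁ * s + q₂ * s)          ≡⟨ cong (rank D) (sym (*-distribʳ-+ s q₁ q₂)) ⟩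
      rank D ((q₁ + q₂) * s)            ≡⟨ rank-dilation (q₁ + q₂) ⟩
      rank D₁ (q₁ + q₂)                 ≡⟨ add₁ q₁ q₂ x∈D y∈D (subst (T ∘ D) (sym (*-distribʳ-+ s q₁ q₂)) x+y∈D) ⟩
      rank D₁ q₁ + rank D₁ q₂           ≡⟨ cong₂ _+_ (rank-dilation q₁) (rank-dilation q₂) ⟨
      rank D (q₁ * s) + rank D (q₂ * s) ∎
      where open ≡-Reasoning

additive-trivial : ∀ {D} → (∀ d → T (D d) → d ≡ 0) → Additive D
additive-trivial D≡0 x y x∈D y∈D _ rewrite D≡0 x x∈D | D≡0 y y∈D = refl

additive-full : ∀ {D B n} → Tiling D B n → (∀ m → m < n → T (D m)) → Additive D
additive-full {D} t full x y _ _ x+y∈D = begin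
  rank D (x + y)            ≡⟨ rank-full D full (x + y) x+y≤n ⟩
  x + y                     ≡⟨ sym (cong₂ _+_ (rank-full D full x (≤-trans (m≤m+n x y) x+y≤n))
                                               (rank-full D full y (≤-trans (m≤n+m y x) x+y≤n))) ⟩
  rank D x + rank D y       ∎
  where
  open ≡-Reasoning
  x+y≤n = <⇒≤ (∈D⇒<n t (x + y) x+y∈D)

sparse-or-trivial : ∀ {D B n} → Tiling D B n → T (B 1) →
                    (∀ d → T (D d) → d ≡ 0) ⊎ Decomposition B D n
sparse-or-trivial t 1∈B with decompose (swap t) 1∈B
... | inj₁ full = inj₁ (full-B⇒D≡0 t full)
... | inj₂ dec  = inj₂ dec

-- With 1 ∈ B, the set D is {0} or lies in tℕ for some t ≥ 2.
no-carry : ∀ {D B n} → Tiling D B n → T (B 1) →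
           ∀ x y → T (D x) → T (D y) → ¬ T (D (suc (x + y)))
no-carry t 1∈B x y x∈D y∈D carry∈D with sparse-or-trivial t 1∈B
... | inj₁ D≡0 = 1+n≢0 (D≡0 _ carry∈D)
... | inj₂ dec = <-irrefl (sym (∣1⇒≡1 s∣1)) 1<s
  where
  open Decomposition dec
  s∣1 : s ∣ 1
  s∣1 = ∣m+n∣m⇒∣n (subst (s ∣_) (+-comm 1 (x + y)) (B-multiple _ carry∈D))
                  (∣m∣n⇒∣m+n (B-multiple x x∈D) (B-multiple y y∈D))

contraction-smaller : ∀ {D B n} (dec : Decomposition D B n) → n > 0 → Decomposition.n₁ dec < n
contraction-smaller dec n>0 =
  subst (n₁ <_) (sym n≡n₁*s) (m<m*n n₁ s {{>-nonZero (n≢0⇒n>0 n₁≢0)}} 1<s)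
  where
  open Decomposition dec
  n₁≢0 : n₁ ≢ 0
  n₁≢0 refl = <-irrefl refl (subst (0 <_) n≡n₁*s n>0)


rank-additive : ∀ {D B n} → Tiling D B n → Additive D
rank-additive {n = n} = <-rec (λ n → ∀ {D B} → Tiling D B n → Additive D) additive n
  where
  additive : ∀ n → (∀ {m} → m < n → ∀ {D B} → Tiling D B m → Additive D) →
             ∀ {D B} → Tiling D B n → Additive D
  additive n rec {D} {B} t with T? (D 1)
  ... | yes 1∈D with decompose t 1∈D
  ...   | inj₁ full = additive-full t full
  ...   | inj₂ dec  = additive-blockwise (rec (contraction-smaller dec (n>0 t)) contraction)
                        (no-carry contraction (subst (T ∘ B) (sym (*-identityˡ s)) s∈B))
    where
    open Decomposition dec
    open Dilation D s
    open Blockwise D-blockwise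
  additive n rec {D} t | no 1∉D with n ≤? 1
  ... | yes n≤1 = additive-trivial λ d d∈D → n≤0⇒n≡0 (≤-pred (≤-trans (∈D⇒<n t d d∈D) n≤1))
  ... | no n≰1 with sparse-or-trivial t (1∉D⇒1∈B t (≰⇒> n≰1) 1∉D)
  ...   | inj₁ D≡0 = additive-trivial D≡0
  ...   | inj₂ dec = additive-dilation (rec (contraction-smaller dec (n>0 t)) (swap contraction))
    where
    open Decomposition dec
    open Dilation D s
    open Sparse B-multiple

open import Data.Integer using (+_)
open import Data.List.Relation.Unary.All using ([]; _∷_)
open import Data.List.Relation.Unary.AllPairs using (_∷_)
open import Data.List.Relation.Unary.Linked using ([]; [-]; _∷_)

module _ {X : Set} where

  remove : ∀ {x : X} (L : List X) → x ∈ L → List X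
  remove (_ ∷ L) (here _)  = L
  remove (y ∷ L) (there p) = y ∷ remove L p

  length-remove : ∀ {x : X} (L : List X) (p : x ∈ L) → suc (length (remove L p)) ≡ length L
  length-remove (_ ∷ L) (here _)  = refl
  length-remove (_ ∷ L) (there p) = cong suc (length-remove L p)

  ∈-remove : ∀ {x z : X} (L : List X) (p : x ∈ L) → z ∈ L → z ≢ x → z ∈ remove L p
  ∈-remove (_ ∷ L) (here refl) (here refl) z≢x = ⊥-elim (z≢x refl)
  ∈-remove (_ ∷ L) (here refl) (there q)   _   = q
  ∈-remove (_ ∷ L) (there p)   (here refl) _   = here refl
  ∈-remove (_ ∷ L) (there p)   (there q)   z≢x = there (∈-remove L p q z≢x)

  Unique⇒length≤ : ∀ {C L : List X} → Unique C → C ⊆ L → length C ≤ length L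
  Unique⇒length≤ {[]}    _             _   = z≤n
  Unique⇒length≤ {c ∷ C} {L} (c∉C ∷ uC) C⊆L =
    subst (suc (length C) ≤_) (length-remove L c∈L) (s≤s (Unique⇒length≤ uC C⊆L-c))
    where
    c∈L = C⊆L (here refl)
    C⊆L-c : C ⊆ remove L c∈L
    C⊆L-c z∈C = ∈-remove L c∈L (C⊆L (there z∈C)) (λ { refl → All.lookup c∉C z∈C refl })

  Unique⇒length< : DecidableEquality X → ∀ {C L₁ L₂ : List X} {v} → Unique C → C ⊆ L₁ ++ L₂ →
                   v ∈ L₁ → v ∈ L₂ → length C < length L₁ + length L₂
  Unique⇒length< _≟_ {C} {L₁} {L₂} {v} uC C⊆L v∈L₁ v∈L₂ =
    subst (length C <_) |L₁-v++L₂|+1 (s≤s (Unique⇒length≤ uC C⊆L₁-v++L₂))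
    where
    C⊆L₁-v++L₂ : C ⊆ remove L₁ v∈L₁ ++ L₂
    C⊆L₁-v++L₂ {z} z∈C with ∈-++⁻ L₁ (C⊆L z∈C)
    ... | inj₂ z∈L₂ = ∈-++⁺ʳ _ z∈L₂
    ... | inj₁ z∈L₁ with z ≟ v
    ...   | yes refl = ∈-++⁺ʳ _ v∈L₂
    ...   | no z≢v   = ∈-++⁺ˡ (∈-remove L₁ v∈L₁ z∈L₁ z≢v)
    |L₁-v++L₂|+1 : suc (length (remove L₁ v∈L₁ ++ L₂)) ≡ length L₁ + length L₂
    |L₁-v++L₂|+1 = trans (cong suc (length-++ (remove L₁ v∈L₁)))
                        (cong (_+ length L₂) (length-remove L₁ v∈L₁))

module _ {X Y Z : Set} (f : X → Y → Z) where

  length-cartesianProductWith : ∀ (A : List X) (B : List Y) →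
                                length (cartesianProductWith f A B) ≡ length A * length B
  length-cartesianProductWith []      B = refl
  length-cartesianProductWith (a ∷ A) B =
    trans (length-++ (map (f a) B)) (cong₂ _+_ (length-map (f a) B) (length-cartesianProductWith A B))

  -- A collision f a b = f a′ b′ with a ≢ a′ lists one value twice among the |A||B| values f x y.
  full-image⇒injectiveˡ : DecidableEquality X → DecidableEquality Z →
    ∀ {A B C} → Unique C → C ⊆ cartesianProductWith f A B → length C ≡ length A * length B →
    ∀ {a b a′ b′} → a ∈ A → b ∈ B → a′ ∈ A → b′ ∈ B → f a b ≡ f a′ b′ → a ≡ a′
  full-image⇒injectiveˡ _≟X_ _≟Z_ {A} {B} {C} uC C⊆AB |C|≡|A||B| {a} {b} {a′} a∈A b∈B a′∈A b′∈B eq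
    with a ≟X a′
  ... | yes a≡a′ = a≡a′
  ... | no a≢a′ = ⊥-elim (<-irrefl |C|≡|A||B|
                    (subst (length C <_) |L₁|+|L₂| (Unique⇒length< _≟Z_ uC C⊆L₁++L₂ fab∈L₁ fab∈L₂)))
    where
    L₁ = map (f a) B
    L₂ = cartesianProductWith f (remove A a∈A) B
    C⊆L₁++L₂ : C ⊆ L₁ ++ L₂
    C⊆L₁++L₂ z∈C with ∈-cartesianProductWith⁻ f A B (C⊆AB z∈C)
    ... | x , y , x∈A , y∈B , refl with x ≟X a
    ...   | yes refl = ∈-++⁺ˡ (∈-map⁺ (f a) y∈B)
    ...   | no x≢a   = ∈-++⁺ʳ L₁ (∈-cartesianProductWith⁺ f (∈-remove A a∈A x∈A x≢a) y∈B)
    fab∈L₁ : f a b ∈ L₁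
    fab∈L₁ = ∈-map⁺ (f a) b∈B
    fab∈L₂ : f a b ∈ L₂
    fab∈L₂ = subst (_∈ L₂) (sym eq) (∈-cartesianProductWith⁺ f (∈-remove A a∈A a′∈A (a≢a′ ∘ sym)) b′∈B)
    |L₁|+|L₂| : length L₁ + length L₂ ≡ length A * length B
    |L₁|+|L₂| = trans (cong₂ _+_ (length-map (f a) B) (length-cartesianProductWith (remove A a∈A) B))
                     (cong (_* length B) (length-remove A a∈A))

module _ {X Y : Set} {P : X → Set} (f : X → Y) where

  map-injectiveOn : (∀ {a b} → P a → P b → f a ≡ f b → a ≡ b) →
                    ∀ {L L′} → All P L → All P L′ → map f L ≡ map f L′ → L ≡ L′
  map-injectiveOn inj []         []         _  = refl
  map-injectiveOn inj (pa ∷ pL) (pb ∷ pL′) eq =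
    cong₂ _∷_ (inj pa pb (∷-injectiveˡ eq)) (map-injectiveOn inj pL pL′ (∷-injectiveʳ eq))

  Linked-map⁺ : ∀ {R : X → X → Set} {S : Y → Y → Set} → (∀ {a b} → P a → P b → R a b → S (f a) (f b)) →
                ∀ {L} → All P L → Linked R L → Linked S (map f L)
  Linked-map⁺ mono _              []       = []
  Linked-map⁺ mono _              [-]      = [-]
  Linked-map⁺ mono (pa ∷ pb ∷ pL) (r ∷ rs) = mono pa pb r ∷ Linked-map⁺ mono (pb ∷ pL) rs

member : (ℕ → ℤ) → List ℤ → ℕ → Bool
member f L m = does (f m ∈? L)

module _ {f : ℕ → ℤ} (f-injective : ∀ {i j} → f i ≡ f j → i ≡ j) where

  member-∷ : ∀ {a i L} → a ≡ f i → a ∉ L → ∀ m →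
             fromBool (member f (a ∷ L) m) ≡ fromBool (does (m ≟ i)) + fromBool (member f L m)
  member-∷ {a} {i} {L} refl fi∉L m with m ≟ i
  ... | yes refl = begin
    fromBool (member f (f i ∷ L) i)
      ≡⟨ cong fromBool (dec-true (f i ∈? f i ∷ L) (here refl)) ⟩
    1 + 0
      ≡⟨ cong₂ _+_ (cong fromBool (dec-true (i ≟ i) refl)) (cong fromBool (dec-false (f i ∈? L) fi∉L)) ⟨
    fromBool (does (i ≟ i)) + fromBool (member f L i)
      ∎
    where open ≡-Reasoning
  ... | no m≢i = begin
    fromBool (member f (f i ∷ L) m)
      ≡⟨ cong fromBool (does-⇔ (mk⇔ drop there) (f m ∈? f i ∷ L) (f m ∈? L)) ⟩
    fromBool (member f L m)
      ≡⟨ cong (λ b → fromBool b + fromBool (member f L m)) (dec-false (m ≟ i) m≢i) ⟨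
    fromBool (does (m ≟ i)) + fromBool (member f L m)
      ∎
    where
    open ≡-Reasoning
    drop : f m ∈ f i ∷ L → f m ∈ L
    drop (here fm≡fi) = ⊥-elim (m≢i (f-injective fm≡fi))
    drop (there fm∈L) = fm∈L

  rank-member : ∀ {n} L → Unique L → All (λ a → ∃ λ i → i < n × a ≡ f i) L →
                rank (member f L) n ≡ length L
  rank-member {n} []  _          _     = none n
    where
    none : ∀ k → rank (member f []) k ≡ 0
    none zero    = refl
    none (suc k) = trans (+-identityʳ _) (none k)
  rank-member {n} (a ∷ L) (a∉L ∷ uL) ((i , i<n , a≡fi) ∷ inRange) = begin
    rank (member f (a ∷ L)) n
      ≡⟨ rank-pointwise-+ (member-∷ a≡fi (λ a∈L → All.lookup a∉L a∈L refl)) n ⟩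
    rank (λ m → does (m ≟ i)) n + rank (member f L) n
      ≡⟨ cong₂ _+_ (rank-singleton i n i<n) (rank-member L uL inRange) ⟩
    suc (length L)
      ∎
    where open ≡-Reasoning

Linked<⇒Unique : ∀ {L} → Linked ℤ._<_ L → Unique L
Linked<⇒Unique L↑ = AllPairs.map ℤ.<⇒≢ (Linked⇒AllPairs ℤ.<-trans L↑)

∈-interval⁻ : ∀ {z n} → z ∈ interval n → ∃ λ i → i < n × z ≡ + suc i
∈-interval⁻ = ∈-applyUpTo⁻ (λ i → + suc i)

∈-interval⁺ : ∀ {i n} → i < n → + suc i ∈ interval n
∈-interval⁺ = ∈-applyUpTo⁺ (λ i → + suc i)

+suc-injective : ∀ {i j} → + suc i ≡ + suc j → i ≡ j
+suc-injective = suc-injective ∘ ℤ.+-injective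

module Embedding {α n : ℕ} {A B : List ℤ} (1≤n : 1 ≤ n) (A-finset : IsFinSet A)
  (A+B≡[n] : IsSumset A B (interval n)) (|[n]|≡|A||B| : length (interval n) ≡ length A * length B)
  (|A|≡α : length A ≡ α) (0∈B : 0ℤ ∈ B) (B≥0 : All (0ℤ ℤ.≤_) B) where

  -- D = A − 1 and B₀ = B as subsets of ℕ, so that D ⊕ B₀ = [0, n).
  D : ℕ → Bool
  D = member (λ m → + suc m) A

  B₀ : ℕ → Bool
  B₀ = member +_ B

  sum∈[n] : ∀ {a b} → a ∈ A → b ∈ B → a ℤ.+ b ∈ interval n
  sum∈[n] {a} {b} a∈A b∈B = Equivalence.from (A+B≡[n] (a ℤ.+ b)) (a , b , a∈A , b∈B , refl)

  A-shape : ∀ {a} → a ∈ A → ∃ λ i → i < n × a ≡ + suc i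
  A-shape {a} a∈A = ∈-interval⁻ (subst (_∈ interval n) (ℤ.+-identityʳ a) (sum∈[n] a∈A 0∈B))

  B-shape : ∀ {b} → b ∈ B → ∃ λ k → b ≡ + k
  B-shape {b} b∈B = ℤ.∣ b ∣ , sym (ℤ.0≤i⇒+∣i∣≡i (All.lookup B≥0 b∈B))

  D⇒∈A : ∀ {d} → T (D d) → + suc d ∈ A
  D⇒∈A = does-sound (_ ∈? A)

  ∈A⇒D : ∀ {d} → + suc d ∈ A → T (D d)
  ∈A⇒D = does-complete (_ ∈? A)

  B₀⇒∈B : ∀ {b} → T (B₀ b) → + b ∈ B
  B₀⇒∈B = does-sound (_ ∈? B)

  ∈B⇒B₀ : ∀ {b} → + b ∈ B → T (B₀ b)
  ∈B⇒B₀ = does-complete (_ ∈? B)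

  cover-[n] : ∀ m → m < n → ∃₂ λ d b → T (D d) × T (B₀ b) × m ≡ d + b
  cover-[n] m m<n with Equivalence.to (A+B≡[n] (+ suc m)) (∈-interval⁺ m<n)
  ... | a , b , a∈A , b∈B , eq with A-shape a∈A | B-shape b∈B
  ...   | d , _ , refl | k , refl = d , k , ∈A⇒D a∈A , ∈B⇒B₀ b∈B , +suc-injective eq

  [n]⊆A+B : interval n ⊆ cartesianProductWith ℤ._+_ A B
  [n]⊆A+B z∈[n] with Equivalence.to (A+B≡[n] _) z∈[n]
  ... | a , b , a∈A , b∈B , refl = ∈-cartesianProductWith⁺ ℤ._+_ a∈A b∈B

  tiling : Tiling D B₀ n
  tiling = record
    { cover  = cover-[n]
    ; bound  = λ d b d∈D b∈B → let i , i<n , eq = ∈-interval⁻ (sum∈[n] (D⇒∈A d∈D) (B₀⇒∈B b∈B))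
                               in subst (_< n) (sym (+suc-injective eq)) i<n
    ; unique = λ d b d′ b′ d∈D b∈B d′∈D b′∈B eq → +suc-injective
        (full-image⇒injectiveˡ ℤ._+_ ℤ._≟_ ℤ._≟_
          (applyUpTo⁺₁ (λ i → + suc i) n λ i<j _ → <⇒≢ i<j ∘ +suc-injective)
          [n]⊆A+B
          |[n]|≡|A||B| (D⇒∈A d∈D) (B₀⇒∈B b∈B) (D⇒∈A d′∈D) (B₀⇒∈B b′∈B)
          (cong (λ k → + suc k) eq))
    ; 0∈D    = let d , b , d∈D , _ , 0≡d+b = cover-[n] 0 1≤n
               in subst (T ∘ D) (m+n≡0⇒m≡0 d (sym 0≡d+b)) d∈D
    ; 0∈B    = ∈B⇒B₀ 0∈B
    }

  rank-D≡α : rank D n ≡ α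
  rank-D≡α = trans (rank-member +suc-injective A (Linked<⇒Unique A-finset) (All.tabulate A-shape)) |A|≡α

  additive : Additive D
  additive = rank-additive tiling

  -- A factor X of A lies in 1 + D and its partner Y in D; rank⁺ and rank⁰ relabel them.
  InD⁺ : ℤ → Set
  InD⁺ x = ∃ λ p → x ≡ + suc p × T (D p)

  InD : ℤ → Set
  InD y = ∃ λ q → y ≡ + q × T (D q)

  rank⁺ : ℤ → ℤ
  rank⁺ x = + suc (rank D (pred ℤ.∣ x ∣))

  rank⁰ : ℤ → ℤ
  rank⁰ y = + rank D ℤ.∣ y ∣

  rank⁺-injective : ∀ {a b} → InD⁺ a → InD⁺ b → rank⁺ a ≡ rank⁺ b → a ≡ b
  rank⁺-injective (p , refl , p∈D) (p′ , refl , p′∈D) eq =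
    cong (λ k → + suc k) (rank-injective D p∈D p′∈D (+suc-injective eq))

  rank⁰-injective : ∀ {a b} → InD a → InD b → rank⁰ a ≡ rank⁰ b → a ≡ b
  rank⁰-injective (q , refl , q∈D) (q′ , refl , q′∈D) eq =
    cong +_ (rank-injective D q∈D q′∈D (ℤ.+-injective eq))

  rank⁺-mono : ∀ {a b} → InD⁺ a → InD⁺ b → a ℤ.< b → rank⁺ a ℤ.< rank⁺ b
  rank⁺-mono (p , refl , p∈D) (p′ , refl , _) a<b =
    ℤ.+<+ (s≤s (rank-strict D p∈D (≤-pred (ℤ.drop‿+<+ a<b))))

  rank⁰-mono : ∀ {a b} → InD a → InD b → a ℤ.< b → rank⁰ a ℤ.< rank⁰ b
  rank⁰-mono (q , refl , q∈D) (q′ , refl , _) a<b =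
    ℤ.+<+ (rank-strict D q∈D (ℤ.drop‿+<+ a<b))

  module Factorisation {α′ : ℕ} {X Y : List ℤ} (X-finset : IsFinSet X) (Y-finset : IsFinSet Y)
    (X+Y≡A : IsSumset X Y A) (|A|≡|X||Y| : length A ≡ length X * length Y) (|X|≡α′ : length X ≡ α′)
    (0∈Y : 0ℤ ∈ Y) (Y≥0 : All (0ℤ ℤ.≤_) Y) where

    sum∈A : ∀ {x y} → x ∈ X → y ∈ Y → x ℤ.+ y ∈ A
    sum∈A {x} {y} x∈X y∈Y = Equivalence.from (X+Y≡A (x ℤ.+ y)) (x , y , x∈X , y∈Y , refl)

    X⊆A : X ⊆ A
    X⊆A {x} x∈X = subst (_∈ A) (ℤ.+-identityʳ x) (sum∈A x∈X 0∈Y)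

    X-shape : ∀ {x} → x ∈ X → InD⁺ x
    X-shape x∈X with A-shape (X⊆A x∈X) | X⊆A x∈X
    ... | p , _ , refl | x∈A = p , refl , ∈A⇒D x∈A

    1∈X : + 1 ∈ X
    1∈X with Equivalence.to (X+Y≡A (+ 1)) (D⇒∈A (Tiling.0∈D tiling))
    ... | x , y , x∈X , y∈Y , eq with X-shape x∈X | All.lookup Y≥0 y∈Y
    ...   | p , refl , _ | ℤ.+≤+ _ with m+n≡0⇒m≡0 p (sym (+suc-injective eq))
    ...     | refl = x∈X

    Y-shape : ∀ {y} → y ∈ Y → InD y
    Y-shape {y} y∈Y with All.lookup Y≥0 y∈Y
    ... | ℤ.+≤+ {n = q} _ = q , refl , ∈A⇒D (sum∈A 1∈X y∈Y)

    sum∈D : ∀ {p q} → + suc p ∈ X → + q ∈ Y → T (D (p + q))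
    sum∈D x∈X y∈Y = ∈A⇒D (sum∈A x∈X y∈Y)

    relabelled-sumset : IsSumset (map rank⁺ X) (map rank⁰ Y) (interval α)
    relabelled-sumset z = mk⇔ to from
      where
      to : z ∈ interval α → ∃₂ λ x′ y′ → x′ ∈ map rank⁺ X × y′ ∈ map rank⁰ Y × z ≡ x′ ℤ.+ y′
      to z∈[α] with ∈-interval⁻ z∈[α]
      ... | i , i<α , refl with rank-surjective D n i (subst (i <_) (sym rank-D≡α) i<α)
      ...   | d , _ , d∈D , rank-d≡i with Equivalence.to (X+Y≡A (+ suc d)) (D⇒∈A d∈D)
      ...     | x , y , x∈X , y∈Y , eq with X-shape x∈X | Y-shape y∈Y
      ...       | p , refl , p∈D | q , refl , q∈D =
        rank⁺ (+ suc p) , rank⁰ (+ q) , ∈-map⁺ rank⁺ x∈X , ∈-map⁺ rank⁰ y∈Y , cong (λ k → + suc k) (begin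
          i                       ≡⟨ sym rank-d≡i ⟩
          rank D d                ≡⟨ cong (rank D) (+suc-injective eq) ⟩
          rank D (p + q)          ≡⟨ additive p q p∈D q∈D (sum∈D x∈X y∈Y) ⟩
          rank D p + rank D q     ∎)
        where open ≡-Reasoning
      from : (∃₂ λ x′ y′ → x′ ∈ map rank⁺ X × y′ ∈ map rank⁰ Y × z ≡ x′ ℤ.+ y′) → z ∈ interval α
      from (x′ , y′ , x′∈ , y′∈ , refl) with ∈-map⁻ rank⁺ x′∈ | ∈-map⁻ rank⁰ y′∈
      ... | x , x∈X , refl | y , y∈Y , refl with X-shape x∈X | Y-shape y∈Y
      ...   | p , refl , p∈D | q , refl , q∈D =
        subst (_∈ interval α) (cong (λ k → + suc k) (additive p q p∈D q∈D p+q∈D))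
          (∈-interval⁺ (subst (rank D (p + q) <_) rank-D≡α
                          (rank-strict D p+q∈D (∈D⇒<n tiling (p + q) p+q∈D))))
        where p+q∈D = sum∈D x∈X y∈Y

    relabelled : InT α′ (interval α) (map rank⁺ X , map rank⁰ Y)
    relabelled = Linked-map⁺ rank⁺ rank⁺-mono (All.tabulate X-shape) X-finset
               , Linked-map⁺ rank⁰ rank⁰-mono (All.tabulate Y-shape) Y-finset
               , relabelled-sumset
               , (begin
                   length (interval α)                          ≡⟨ length-applyUpTo _ α ⟩
                   α                                            ≡⟨ |A|≡α ⟨
                   length A                                     ≡⟨ |A|≡|X||Y| ⟩
                   length X * length Y                          ≡⟨ cong₂ _*_ (length-map rank⁺ X) (length-map rank⁰ Y) ⟨
                   length (map rank⁺ X) * length (map rank⁰ Y)  ∎)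
               , trans (length-map rank⁺ X) |X|≡α′
               , ∈-map⁺ rank⁰ 0∈Y
               , All.map⁺ (All.universal (λ _ → ℤ.+≤+ z≤n) Y)
      where open ≡-Reasoning

  relabel : List ℤ × List ℤ → List ℤ × List ℤ
  relabel (X , Y) = map rank⁺ X , map rank⁰ Y

  relabel-InT : ∀ {α′} p → InT α′ A p → InT α′ (interval α) (relabel p)
  relabel-InT (X , Y) (X↑ , Y↑ , X+Y≡A , |A|≡|X||Y| , |X|≡α′ , 0∈Y , Y≥0) =
    Factorisation.relabelled X↑ Y↑ X+Y≡A |A|≡|X||Y| |X|≡α′ 0∈Y Y≥0

  InT-shape : ∀ {α′ X Y} → InT α′ A (X , Y) → All InD⁺ X × All InD Y
  InT-shape (X↑ , Y↑ , X+Y≡A , |A|≡|X||Y| , |X|≡α′ , 0∈Y , Y≥0) =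
    All.tabulate X-shape , All.tabulate Y-shape
    where open Factorisation X↑ Y↑ X+Y≡A |A|≡|X||Y| |X|≡α′ 0∈Y Y≥0

  relabel-injective : ∀ {α′} p q → InT α′ A p → InT α′ A q → relabel p ≡ relabel q → p ≡ q
  relabel-injective (X , Y) (X′ , Y′) hp hq eq with InT-shape hp | InT-shape hq
  ... | X⊆D⁺ , Y⊆D | X′⊆D⁺ , Y′⊆D =
    cong₂ _,_ (map-injectiveOn rank⁺ rank⁺-injective X⊆D⁺ X′⊆D⁺ (cong proj₁ eq))
              (map-injectiveOn rank⁰ rank⁰-injective Y⊆D Y′⊆D (cong proj₂ eq))

lemma17 : (α α′ n : ℕ) → 1 ≤ α → 1 ≤ α′ → 1 ≤ n →
          (A B : List ℤ) → InT α (interval n) (A , B) →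
          CardLe (InT α′ A) (InT α′ (interval α))
lemma17 α α′ n _ _ 1≤n A B (A↑ , _ , A+B≡[n] , |[n]|≡|A||B| , |A|≡α , 0∈B , B≥0) =
  relabel , relabel-InT , relabel-injective
  where open Embedding 1≤n A↑ A+B≡[n] |[n]|≡|A||B| |A|≡α 0∈B B≥0
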